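{- Let $n\ge 1$, $N=\binom{n}{2}$ and $m> N/2$. Let $P$ and $Q$ be finite collections (multisets) of graphs with $n$ vertices and $m$ edges such that $d_1X_P=d_1X_Q$ or $\Delta_1X_P=\Delta_1X_Q$. Then $X_P=X_Q$.
   Context: All graphs are simple. For a graph $G$ with $n$ vertices and $m$ edges, the $1$-edge deck $ED_1(G)$ is the multiset of the $m$ graphs $G-e$, $e\in E(G)$; the modified $1$-deck $MD_1(G)$ is the multiset of graphs $G-e+f$ where $e\in E(G)$ and $f$ ranges over all non-edges of $G-e$ (including $f=e$). For a finite multiset $S$ of graphs, its characteristic vector $X_S$ is indexed by isomorphism classes of graphs on $n$ vertices (with the relevant number of edges), the entry at a class being the number of members of $S$ in that class. $d_1$ is the matrix with rows indexed by isomorphism classes of $n$-vertex $(m-1)$-edge graphs and columns by isomorphism classes of $n$-vertex $m$-edge graphs, whose $(k,l)$ entry is the number of members of $ED_1(G_l)$ isomorphic to $G_k$. $\Delta_1$ is the square matrix indexed by isomorphism classes of $n$-vertex $m$-edge graphs whose $(k,l)$ entry is the number of members of $MD_1(G_l)$ isomorphic to $G_k$. -}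

module Defs where

open import Data.Nat using (ℕ; _∸_)
open import Data.Bool using (Bool; true; false; _∧_; not; if_then_else_)
open import Data.Fin using (Fin; _<_; _<?_; _≟_)
open import Data.Fin.Permutation using (Permutation′; _⟨$⟩ʳ_)
open import Data.List using (List; []; _∷_; allFin; concatMap; filter; length; map)
open import Data.Nat.ListAction using (sum)
open import Data.Product using (Σ; _×_; _,_; proj₁; proj₂)
open import Relation.Nullary using (Dec; yes; no; does)
open import Relation.Binary.PropositionalEquality using (_≡_)

-- An unordered pair {i , j} of distinct vertices, stored as (i , j) with i < j.
record Pair (n : ℕ) : Set where
  constructor pair
  field
    fst : Fin n
    snd : Fin n
    lt  : fst < snd
open Pair public

allPairs : (n : ℕ) → List (Pair n)
allPairs n = concatMap (λ i → concatMap (λ j → mk i j) (allFin n)) (allFin n)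
  where
  mk : Fin n → Fin n → List (Pair n)
  mk i j with i <? j
  ... | yes p = pair i j p ∷ []
  ... | no _  = []

samePair : {n : ℕ} → Pair n → Pair n → Bool
samePair p q = does (fst p ≟ fst q) ∧ does (snd p ≟ snd q)

Graph : ℕ → Set
Graph n = Pair n → Bool

adj : {n : ℕ} → Graph n → Fin n → Fin n → Bool
adj G i j with i <? j | j <? i
... | yes p | _     = G (pair i j p)
... | no _  | yes q = G (pair j i q)
... | no _  | no _  = false

edges : {n : ℕ} → Graph n → List (Pair n)
edges {n} G = filter (λ p → Data.Bool._≟_ (G p) true) (allPairs n)

nonEdges : {n : ℕ} → Graph n → List (Pair n)
nonEdges {n} G = filter (λ p → Data.Bool._≟_ (G p) false) (allPairs n)

∥_∥ : {n : ℕ} → Graph n → ℕ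
∥ G ∥ = length (edges G)

_≅_ : {n : ℕ} → Graph n → Graph n → Set
_≅_ {n} G H = Σ (Permutation′ n) λ σ → ∀ i j → adj G i j ≡ adj H (σ ⟨$⟩ʳ i) (σ ⟨$⟩ʳ j)

_─_ : {n : ℕ} → Graph n → Pair n → Graph n
(G ─ e) p = G p ∧ not (samePair p e)

_⊕_ : {n : ℕ} → Graph n → Pair n → Graph n
(G ⊕ f) p = if samePair p f then true else G p

-- 1-edge deck ED_1(G) (as a list = multiset).
ED1 : {n : ℕ} → Graph n → List (Graph n)
ED1 G = map (λ e → G ─ e) (edges G)

-- Modified 1-deck MD_1(G): G - e + f, e ∈ E(G), f a non-edge of G - e (f = e allowed).
MD1 : {n : ℕ} → Graph n → List (Graph n)
MD1 G = concatMap (λ e → map (λ f → (G ─ e) ⊕ f) (nonEdges (G ─ e))) (edges G)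

-- A decision procedure for isomorphism (any one; counts do not depend on the choice).
IsoDec : ℕ → Set
IsoDec n = (G H : Graph n) → Dec (G ≅ H)

countIso : {n : ℕ} → IsoDec n → Graph n → List (Graph n) → ℕ
countIso iso? H S = length (filter (λ G → iso? G H) S)

-- Characteristic vector X_S, evaluated at the isomorphism class of H.
X : {n : ℕ} → IsoDec n → List (Graph n) → Graph n → ℕ
X iso? S H = countIso iso? H S

d1 : {n : ℕ} → IsoDec n → Graph n → Graph n → ℕ
d1 iso? H G = countIso iso? H (ED1 G)

Δ1 : {n : ℕ} → IsoDec n → Graph n → Graph n → ℕ
Δ1 iso? H G = countIso iso? H (MD1 G)

-- Matrix times characteristic vector:
-- (M X_P)_[H] = Σ_l M([H],l) X_P(l) = Σ_{G ∈ P} M([H],[G]).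
_·X_ : {n : ℕ} → (Graph n → Graph n → ℕ) → List (Graph n) → Graph n → ℕ
(M ·X P) H = sum (map (M H) P)

-- The argument is dual: instead of characteristic vectors it uses isomorphism-invariant test
-- functions ψ from graphs to ℤ, with Uψ(G) = Σ_f ψ(G + f) over the non-edges f of G and
-- Dψ(G) = Σ_e ψ(G − e) over its edges e. Then Σ_{G ∈ P} Dφ(G) = ⟨d1 X_P, φ⟩ and
-- Σ_{G ∈ P} DUψ(G) = ⟨Δ1 X_P, ψ⟩, so either hypothesis gives Σ_P DUψ = Σ_Q DUψ for every
-- invariant ψ. Double counting gives DU = UD + (2|E(G)| − N) at a graph G, and by induction
-- D U^{j+1} = U^{j+1} D + s_j U^j on m-edge graphs, where s_j = Σ_{i ≤ j} (2(m + i) − N) > 0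
-- because 2m > N. Hence agreement of the sums of U^{j+1}(·) over P and Q forces agreement of the
-- sums of U^j(·). As U^j ψ vanishes on m-edge graphs once m + j > N, descending induction on j
-- gives Σ_P ψ = Σ_Q ψ; taking for ψ the indicator of the class of H gives X_P(H) = X_Q(H).

module Submission where

open import Defs
open import Data.Nat using (ℕ; _≤_; _<_; _*_; _∸_)
open import Data.Nat.Combinatorics using (_C_)
open import Data.List using (List)
open import Data.List.Relation.Unary.All using (All)
open import Data.Sum using (_⊎_)
open import Relation.Binary.PropositionalEquality using (_≡_)

open import Algebra.Properties.AbelianGroup using (∙-cancelˡ)
open import Data.Bool as Bool using (Bool; true; false; _∧_; _∨_; not; if_then_else_)
import Data.Bool.Properties as Bool
open import Data.Empty using (⊥-elim; ⊥-elim-irr)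
open import Data.Fin as Fin using (Fin)
import Data.Fin.Properties as Fin
open import Data.Fin.Permutation using (Permutation′; _⟨$⟩ʳ_; _⟨$⟩ˡ_; inverseˡ; inverseʳ; flip; _∘ₚ_; id)
open import Data.Integer as ℤ using (ℤ; +_; 0ℤ; 1ℤ; _+_; _-_; _⊖_)
import Data.Integer.Properties as ℤ
open import Data.Integer.Tactic.RingSolver using (solve-∀)
open import Data.List as List using ([]; _∷_; _++_; map; concatMap; filter; length; allFin)
import Data.List.Properties as List
open import Data.List.Relation.Unary.All as All using ([]; _∷_)
import Data.List.Relation.Unary.All.Properties as All
open import Data.Nat as ℕ using (zero; suc)
import Data.Nat.Properties as ℕ
open import Data.Nat.Combinatorics using (nC1≡n; nCk+nC[k+1]≡[n+1]C[k+1])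
open import Data.Nat.ListAction using (sum)
open import Data.Product using (_,_; proj₁; proj₂)
open import Data.Sum using (inj₁; inj₂)
open import Function using (_∘_)
open import Function.Bundles using (mk⇔)
open import Level using (0ℓ)
open import Relation.Binary using (DecSetoid; DecidableEquality; _Preserves_⟶_; tri<; tri≈; tri>)
open import Relation.Binary.PropositionalEquality
  using (_≢_; refl; sym; trans; cong; cong₂; subst; subst₂; module ≡-Reasoning)
open import Relation.Nullary using (¬_; ¬?; Dec; yes; no; does; proof)
open import Relation.Nullary.Decidable using (map′; _×-dec_; dec-true; dec-false; does-⇔)
open import Relation.Nullary.Reflects using (Reflects; invert)
open import Relation.Unary using (Decidable)

private
  variable
    A B : Set

∑ : List A → (A → ℤ) → ℤ
∑ []       f = 0ℤ
∑ (x ∷ xs) f = f x + ∑ xs f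


∑-cong : ∀ (xs : List A) {f g : A → ℤ} → (∀ x → f x ≡ g x) → ∑ xs f ≡ ∑ xs g
∑-cong []       f≗g = refl
∑-cong (x ∷ xs) f≗g = cong₂ _+_ (f≗g x) (∑-cong xs f≗g)

∑-cong-All : ∀ {xs : List A} {f g : A → ℤ} → All (λ x → f x ≡ g x) xs → ∑ xs f ≡ ∑ xs g
∑-cong-All []               = refl
∑-cong-All (fx≡gx ∷ f≗g) = cong₂ _+_ fx≡gx (∑-cong-All f≗g)

∑-zero : ∀ (xs : List A) → ∑ xs (λ _ → 0ℤ) ≡ 0ℤ
∑-zero []       = refl
∑-zero (x ∷ xs) = trans (ℤ.+-identityˡ _) (∑-zero xs)

∑-distrib-+ : ∀ (xs : List A) (f g : A → ℤ) → ∑ xs (λ x → f x + g x) ≡ ∑ xs f + ∑ xs g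
∑-distrib-+ []       f g = refl
∑-distrib-+ (x ∷ xs) f g =
  trans (cong (_+_ (f x + g x)) (∑-distrib-+ xs f g)) (interchange (f x) (g x) (∑ xs f) (∑ xs g))
  where
  interchange : ∀ a b c d → a + b + (c + d) ≡ a + c + (b + d)
  interchange = solve-∀

*-distribˡ-∑ : ∀ (c : ℤ) (xs : List A) (f : A → ℤ) → c ℤ.* ∑ xs f ≡ ∑ xs (λ x → c ℤ.* f x)
*-distribˡ-∑ c []       f = ℤ.*-zeroʳ c
*-distribˡ-∑ c (x ∷ xs) f =
  trans (ℤ.*-distribˡ-+ c (f x) (∑ xs f)) (cong (_+_ (c ℤ.* f x)) (*-distribˡ-∑ c xs f))

∑-const : ∀ (xs : List A) (c : ℤ) → ∑ xs (λ _ → c) ≡ + length xs ℤ.* c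
∑-const []       c = sym (ℤ.*-zeroˡ c)
∑-const (x ∷ xs) c = trans (cong (_+_ c) (∑-const xs c)) (one-more c (+ length xs))
  where
  one-more : ∀ c k → c + k ℤ.* c ≡ (1ℤ + k) ℤ.* c
  one-more = solve-∀

∑-1 : ∀ (xs : List A) → ∑ xs (λ _ → 1ℤ) ≡ + length xs
∑-1 xs = trans (∑-const xs 1ℤ) (ℤ.*-identityʳ _)

∑-++ : ∀ (xs ys : List A) (f : A → ℤ) → ∑ (xs ++ ys) f ≡ ∑ xs f + ∑ ys f
∑-++ []       ys f = sym (ℤ.+-identityˡ _)
∑-++ (x ∷ xs) ys f = trans (cong (_+_ (f x)) (∑-++ xs ys f)) (sym (ℤ.+-assoc (f x) _ _))

∑-comm : (xs : List A) (ys : List B) (f : A → B → ℤ) →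
         ∑ xs (λ x → ∑ ys (f x)) ≡ ∑ ys (λ y → ∑ xs (λ x → f x y))
∑-comm []       ys f = sym (∑-zero ys)
∑-comm (x ∷ xs) ys f =
  trans (cong (_+_ (∑ ys (f x))) (∑-comm xs ys f)) (sym (∑-distrib-+ ys (f x) _))

∑-map : (g : A → B) (xs : List A) (f : B → ℤ) → ∑ (map g xs) f ≡ ∑ xs (λ x → f (g x))
∑-map g []       f = refl
∑-map g (x ∷ xs) f = cong (_+_ (f (g x))) (∑-map g xs f)

∑-concatMap : (g : A → List B) (xs : List A) (f : B → ℤ) →
              ∑ (concatMap g xs) f ≡ ∑ xs (λ x → ∑ (g x) f)
∑-concatMap g []       f = refl
∑-concatMap g (x ∷ xs) f =
  trans (∑-++ (g x) (concatMap g xs) f) (cong (_+_ (∑ (g x) f)) (∑-concatMap g xs f))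

∑-filter : ∀ {P : A → Set} (P? : Decidable P) (xs : List A) (f : A → ℤ) →
           ∑ (filter P? xs) f ≡ ∑ xs (λ x → if does (P? x) then f x else 0ℤ)
∑-filter P? []       f = refl
∑-filter P? (x ∷ xs) f with does (P? x)
... | true  = cong (_+_ (f x)) (∑-filter P? xs f)
... | false = trans (∑-filter P? xs f) (sym (ℤ.+-identityˡ _))

-- Raising and lowering operators on a graded set

module UpDown {X : Set} (rank : X → ℕ) (N : ℕ) (up down : X → List X)
  (rank≤N : ∀ x → rank x ≤ N)
  (rank-up : ∀ x → All (λ y → rank y ≡ suc (rank x)) (up x))
  where

  U D : (X → ℤ) → X → ℤ
  U ψ x = ∑ (up x) ψ
  D ψ x = ∑ (down x) ψ

  U^ : ℕ → (X → ℤ) → X → ℤ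
  U^ zero    ψ = ψ
  U^ (suc j) ψ = U (U^ j ψ)

  weight : ℕ → ℤ
  weight r = (r ℕ.+ r) ⊖ N

  weightSum : ℕ → ℕ → ℤ
  weightSum r zero    = weight r
  weightSum r (suc j) = weight r + weightSum (suc r) j

  weight≡ : ∀ r → weight r ≡ + r + + r - + N
  weight≡ r = sym (trans (cong (_- + N) (sym (ℤ.pos-+ r r))) (ℤ.m-n≡m⊖n (r ℕ.+ r) N))

  weight-positive : ∀ {r} → N < r ℕ.+ r → 0ℤ ℤ.< weight r
  weight-positive {r} N<2r = subst (ℤ._< weight r) (ℤ.n⊖n≡0 N) (ℤ.⊖-monoˡ-< N N<2r)

  weightSum-positive : ∀ {r} → N < r ℕ.+ r → ∀ j → 0ℤ ℤ.< weightSum r j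
  weightSum-positive {r} N<2r zero    = weight-positive {r} N<2r
  weightSum-positive {r} N<2r (suc j) =
    ℤ.+-mono-< (weight-positive {r} N<2r) (weightSum-positive {suc r} N<2[r+1] j)
    where
    N<2[r+1] : N < suc r ℕ.+ suc r
    N<2[r+1] = ℕ.<-≤-trans N<2r (ℕ.+-mono-≤ (ℕ.n≤1+n r) (ℕ.n≤1+n r))

  U-scale : ∀ (c : ℕ → ℤ) ψ x → U (λ y → c (rank y) ℤ.* ψ y) x ≡ c (suc (rank x)) ℤ.* U ψ x
  U-scale c ψ x =
    trans (∑-cong-All (All.map (λ {y} → cong (λ r → c r ℤ.* ψ y)) (rank-up x)))
          (sym (*-distribˡ-∑ (c (suc (rank x))) (up x) ψ))

  U^-vanishes : ∀ j ψ x → N < rank x ℕ.+ j → U^ j ψ x ≡ 0ℤ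
  U^-vanishes zero    ψ x N<r   = ⊥-elim (ℕ.<⇒≱ (subst (N <_) (ℕ.+-identityʳ _) N<r) (rank≤N x))
  U^-vanishes (suc j) ψ x N<r+1+j =
    trans (∑-cong-All (All.map (λ {y} ry≡r+1 → U^-vanishes j ψ y (N<ry+j ry≡r+1)) (rank-up x)))
          (∑-zero (up x))
    where
    N<ry+j : ∀ {y} → rank y ≡ suc (rank x) → N < rank y ℕ.+ j
    N<ry+j ry≡r+1 = subst (λ r → N < r ℕ.+ j) (sym ry≡r+1) (subst (N <_) (ℕ.+-suc (rank x) j) N<r+1+j)

  module Commuting (Invariant : (X → ℤ) → Set)
    (U-invariant : ∀ {ψ} → Invariant ψ → Invariant (U ψ))
    (D-invariant : ∀ {ψ} → Invariant ψ → Invariant (D ψ))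
    (DU≡UD+weight : ∀ {ψ} → Invariant ψ → ∀ x → D (U ψ) x ≡ U (D ψ) x + weight (rank x) ℤ.* ψ x)
    where

    U^-invariant : ∀ j {ψ} → Invariant ψ → Invariant (U^ j ψ)
    U^-invariant zero    inv = inv
    U^-invariant (suc j) inv = U-invariant (U^-invariant j inv)

    DU^≡U^D+weightSum : ∀ j {ψ} → Invariant ψ → ∀ x →
      D (U^ (suc j) ψ) x ≡ U^ (suc j) (D ψ) x + weightSum (rank x) j ℤ.* U^ j ψ x
    DU^≡U^D+weightSum zero        inv x = DU≡UD+weight inv x
    DU^≡U^D+weightSum (suc j) {ψ} inv x = begin
        D (U (U^ (suc j) ψ)) x
      ≡⟨ DU≡UD+weight (U^-invariant (suc j) inv) x ⟩
        U (D (U^ (suc j) ψ)) x + w ℤ.* u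
      ≡⟨ cong (_+ w ℤ.* u) (∑-cong (up x) (DU^≡U^D+weightSum j inv)) ⟩
        U (λ y → U^ (suc j) (D ψ) y + weightSum (rank y) j ℤ.* U^ j ψ y) x + w ℤ.* u
      ≡⟨ cong (_+ w ℤ.* u) (∑-distrib-+ (up x) _ _) ⟩
        U^ (suc (suc j)) (D ψ) x + U (λ y → weightSum (rank y) j ℤ.* U^ j ψ y) x + w ℤ.* u
      ≡⟨ cong (λ t → U^ (suc (suc j)) (D ψ) x + t + w ℤ.* u) (U-scale (λ r → weightSum r j) (U^ j ψ) x) ⟩
        U^ (suc (suc j)) (D ψ) x + weightSum (suc (rank x)) j ℤ.* u + w ℤ.* u
      ≡⟨ collect (U^ (suc (suc j)) (D ψ) x) (weightSum (suc (rank x)) j) w u ⟩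
        U^ (suc (suc j)) (D ψ) x + (w + weightSum (suc (rank x)) j) ℤ.* u
      ∎
      where
      open ≡-Reasoning
      w u : ℤ
      w = weight (rank x)
      u = U^ (suc j) ψ x
      collect : ∀ a s w u → a + s ℤ.* u + w ℤ.* u ≡ a + (w + s) ℤ.* u
      collect = solve-∀

    ∑-DU^ : ∀ {m xs} → All (λ x → rank x ≡ m) xs → ∀ j {ψ} → Invariant ψ →
            ∑ xs (D (U^ (suc j) ψ)) ≡ ∑ xs (U^ (suc j) (D ψ)) + weightSum m j ℤ.* ∑ xs (U^ j ψ)
    ∑-DU^ {m} {xs} ranks j {ψ} inv =
      trans (∑-cong-All (All.map (λ {x} rx≡m → trans (DU^≡U^D+weightSum j inv x)
                                   (cong (λ r → U^ (suc j) (D ψ) x + weightSum r j ℤ.* U^ j ψ x) rx≡m)) ranks))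
            (trans (∑-distrib-+ xs _ _)
                   (cong (_+_ (∑ xs (U^ (suc j) (D ψ)))) (sym (*-distribˡ-∑ (weightSum m j) xs (U^ j ψ)))))

    sums-agree : ∀ {m} {P Q : List X} → N < m ℕ.+ m →
      All (λ x → rank x ≡ m) P → All (λ x → rank x ≡ m) Q →
      (∀ {ψ} → Invariant ψ → ∑ P (D (U ψ)) ≡ ∑ Q (D (U ψ))) →
      ∀ {ψ} → Invariant ψ → ∑ P ψ ≡ ∑ Q ψ
    sums-agree {m} {P} {Q} N<2m rankP rankQ DU-agree = agree N 0 (ℕ.≤-reflexive (sym (ℕ.+-identityʳ N)))
      where
      Agree : ℕ → Set
      Agree j = ∀ {ψ} → Invariant ψ → ∑ P (U^ j ψ) ≡ ∑ Q (U^ j ψ)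

      m>0 : 0 < m
      m>0 = ℕ.n≢0⇒n>0 λ { refl → ℕ.n≮0 N<2m }

      vanishes : ∀ {xs} → All (λ x → rank x ≡ m) xs → ∀ j ψ → N < m ℕ.+ j → ∑ xs (U^ j ψ) ≡ 0ℤ
      vanishes {xs} ranks j ψ N<m+j =
        trans (∑-cong-All (All.map (λ {x} rx≡m → U^-vanishes j ψ x (subst (λ r → N < r ℕ.+ j) (sym rx≡m) N<m+j))
                                   ranks))
              (∑-zero xs)

      agree-step : ∀ j → Agree (suc j) → Agree j
      agree-step j agree₊ {ψ} inv =
        ℤ.*-cancelˡ-≡ (weightSum m j) _ _ {{ℤ.>-nonZero (weightSum-positive N<2m j)}}
          (∙-cancelˡ ℤ.+-0-abelianGroup (∑ P (U^ (suc j) (D ψ))) _ _ (begin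
              ∑ P (U^ (suc j) (D ψ)) + weightSum m j ℤ.* ∑ P (U^ j ψ)
            ≡⟨ sym (∑-DU^ rankP j inv) ⟩
              ∑ P (D (U^ (suc j) ψ))
            ≡⟨ DU-agree (U^-invariant j inv) ⟩
              ∑ Q (D (U^ (suc j) ψ))
            ≡⟨ ∑-DU^ rankQ j inv ⟩
              ∑ Q (U^ (suc j) (D ψ)) + weightSum m j ℤ.* ∑ Q (U^ j ψ)
            ≡⟨ cong (_+ weightSum m j ℤ.* ∑ Q (U^ j ψ)) (sym (agree₊ (D-invariant inv))) ⟩
              ∑ P (U^ (suc j) (D ψ)) + weightSum m j ℤ.* ∑ Q (U^ j ψ)
            ∎))
        where open ≡-Reasoning

      agree : ∀ d j → N ≤ d ℕ.+ j → Agree j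
      agree zero    j N≤j     {ψ} _ =
        trans (vanishes rankP j ψ N<m+j) (sym (vanishes rankQ j ψ N<m+j))
        where
        N<m+j : N < m ℕ.+ j
        N<m+j = ℕ.≤-<-trans N≤j (ℕ.m<n+m j m>0)
      agree (suc d) j N≤1+d+j = agree-step j (agree d (suc j) (subst (N ≤_) (sym (ℕ.+-suc d j)) N≤1+d+j))

∑-allFin-suc : ∀ {n} (f : Fin (suc n) → ℤ) → ∑ (allFin (suc n)) f ≡ f Fin.zero + ∑ (allFin n) (f ∘ Fin.suc)
∑-allFin-suc {n} f =
  cong (_+_ (f Fin.zero)) (trans (cong (λ xs → ∑ xs f) (sym (List.map-tabulate (λ i → i) Fin.suc)))
                                 (∑-map Fin.suc (allFin n) f))

∑-allFin-δ : ∀ {n} (a : Fin n) (f : Fin n → ℤ) →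
             ∑ (allFin n) (λ i → if does (i Fin.≟ a) then f i else 0ℤ) ≡ f a
∑-allFin-δ {suc n} Fin.zero    f =
  trans (∑-allFin-suc (λ i → if does (i Fin.≟ Fin.zero) then f i else 0ℤ))
        (trans (cong (_+_ (f Fin.zero)) (∑-zero (allFin n))) (ℤ.+-identityʳ _))
∑-allFin-δ {suc n} (Fin.suc a) f =
  trans (∑-allFin-suc (λ i → if does (i Fin.≟ Fin.suc a) then f i else 0ℤ))
        (trans (ℤ.+-identityˡ _) (∑-allFin-δ a (f ∘ Fin.suc)))

∑-allFin-< : ∀ n → ∑ (allFin n) (λ i → ∑ (allFin n) (λ j → if does (i Fin.<? j) then 1ℤ else 0ℤ)) ≡
                   + (n C 2)
∑-allFin-< zero    = refl
∑-allFin-< (suc n) = begin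
    ∑ (allFin (suc n)) (λ i → ∑ (allFin (suc n)) (λ j → [ i < j ]))
  ≡⟨ ∑-allFin-suc (λ i → ∑ (allFin (suc n)) (λ j → [ i < j ])) ⟩
    ∑ (allFin (suc n)) (λ j → [ Fin.zero < j ])
      + ∑ (allFin n) (λ i → ∑ (allFin (suc n)) (λ j → [ Fin.suc i < j ]))
  ≡⟨ cong₂ _+_ first-row other-rows ⟩
    + n + ∑ (allFin n) (λ i → ∑ (allFin n) (λ j → [ i < j ]))
  ≡⟨ cong (_+_ (+ n)) (∑-allFin-< n) ⟩
    + (n ℕ.+ n C 2)
  ≡⟨ cong +_ (trans (cong (ℕ._+ n C 2) (sym (nC1≡n n))) (nCk+nC[k+1]≡[n+1]C[k+1] n 1)) ⟩
    + (suc n C 2)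
  ∎
  where
  open ≡-Reasoning
  [_<_] : ∀ {k} → Fin k → Fin k → ℤ
  [ i < j ] = if does (i Fin.<? j) then 1ℤ else 0ℤ
  first-row : ∑ (allFin (suc n)) (λ j → [ Fin.zero < j ]) ≡ + n
  first-row = trans (∑-allFin-suc {n} (λ j → [ Fin.zero < j ]))
                    (trans (ℤ.+-identityˡ _) (trans (∑-1 (allFin n)) (cong +_ (List.length-tabulate (λ i → i)))))
  other-rows : ∑ (allFin n) (λ i → ∑ (allFin (suc n)) (λ j → [ Fin.suc i < j ])) ≡
               ∑ (allFin n) (λ i → ∑ (allFin n) (λ j → [ i < j ]))
  other-rows = ∑-cong (allFin n) (λ i → trans (∑-allFin-suc {n} (λ j → [ Fin.suc i < j ])) (ℤ.+-identityˡ _))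

module _ {n : ℕ} where

  pair-≡ : ∀ {p q : Pair n} → fst p ≡ fst q → snd p ≡ snd q → p ≡ q
  pair-≡ {pair a b a<b} {pair .a .b a<b′} refl refl = cong (pair a b) (Fin.<-irrelevant a<b a<b′)

  -- Chosen so that samePair p q is definitionally does (p ≟ₚ q).
  _≟ₚ_ : DecidableEquality (Pair n)
  p ≟ₚ q = map′ (λ eqs → pair-≡ (proj₁ eqs) (proj₂ eqs)) (λ { refl → refl , refl })
                ((fst p Fin.≟ fst q) ×-dec (snd p Fin.≟ snd q))

  samePair⇒≡ : ∀ {p q : Pair n} → samePair p q ≡ true → p ≡ q
  samePair⇒≡ {p} {q} p~q = invert (subst (Reflects (p ≡ q)) p~q (proof (p ≟ₚ q)))

  samePair-refl : ∀ (p : Pair n) → samePair p p ≡ true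
  samePair-refl p = dec-true (p ≟ₚ p) refl

  -- allPairs is defined through a helper local to Defs; it is recovered here by unification.
  cell : Fin n → Fin n → List (Pair n)
  cell = cells-of refl
    where
    cells-of : ∀ {c : Fin n → Fin n → List (Pair n)} →
               allPairs n ≡ concatMap (λ i → concatMap (c i) (allFin n)) (allFin n) →
               Fin n → Fin n → List (Pair n)
    cells-of {c} _ = c

  cellOf : ∀ i j → Dec (i Fin.< j) → List (Pair n)
  cellOf i j (yes i<j) = pair i j i<j ∷ []
  cellOf i j (no _)    = []

  cell-dec : ∀ i j → cell i j ≡ cellOf i j (i Fin.<? j)
  cell-dec i j with i Fin.<? j
  ... | yes _ = refl
  ... | no _  = refl

  ∑-allPairs : ∀ (g : Pair n → ℤ) →
               ∑ (allPairs n) g ≡ ∑ (allFin n) (λ i → ∑ (allFin n) (λ j → ∑ (cellOf i j (i Fin.<? j)) g))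
  ∑-allPairs g =
    trans (∑-concatMap _ (allFin n) g) (∑-cong (allFin n) λ i →
      trans (∑-concatMap _ (allFin n) g) (∑-cong (allFin n) λ j → cong (λ xs → ∑ xs g) (cell-dec i j)))

  ∑-allPairs-δ : ∀ (e : Pair n) (h : Pair n → ℤ) →
                 ∑ (allPairs n) (λ p → if samePair p e then h p else 0ℤ) ≡ h e
  ∑-allPairs-δ e@(pair a b a<b) h = begin
      ∑ (allPairs n) (λ p → if samePair p e then h p else 0ℤ)
    ≡⟨ ∑-allPairs _ ⟩
      ∑ (allFin n) (λ i → ∑ (allFin n) (λ j →
        ∑ (cellOf i j (i Fin.<? j)) (λ p → if samePair p e then h p else 0ℤ)))
    ≡⟨ ∑-cong (allFin n) (λ i → ∑-cong (allFin n) (at-cell i)) ⟩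
      ∑ (allFin n) (λ i → ∑ (allFin n) (λ j →
        if does (j Fin.≟ b) then (if does (i Fin.≟ a) then h e else 0ℤ) else 0ℤ))
    ≡⟨ ∑-cong (allFin n) (λ i → ∑-allFin-δ b _) ⟩
      ∑ (allFin n) (λ i → if does (i Fin.≟ a) then h e else 0ℤ)
    ≡⟨ ∑-allFin-δ a _ ⟩
      h e
    ∎
    where
    open ≡-Reasoning
    at-cell : ∀ i j → ∑ (cellOf i j (i Fin.<? j)) (λ p → if samePair p e then h p else 0ℤ)
                      ≡ (if does (j Fin.≟ b) then (if does (i Fin.≟ a) then h e else 0ℤ) else 0ℤ)
    at-cell i j with i Fin.<? j
    ... | yes i<j with i Fin.≟ a | j Fin.≟ b
    ...   | yes refl | yes refl = trans (ℤ.+-identityʳ _) (cong h (pair-≡ refl refl))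
    ...   | yes _    | no _     = refl
    ...   | no _     | yes _    = refl
    ...   | no _     | no _     = refl
    at-cell i j | no i≮j with i Fin.≟ a | j Fin.≟ b
    ...   | yes refl | yes refl = ⊥-elim (i≮j a<b)
    ...   | yes _    | no _     = refl
    ...   | no _     | yes _    = refl
    ...   | no _     | no _     = refl

  length-allPairs : length (allPairs n) ≡ n C 2
  length-allPairs = ℤ.+-injective (begin
      + length (allPairs n)
    ≡⟨ sym (∑-1 (allPairs n)) ⟩
      ∑ (allPairs n) (λ _ → 1ℤ)
    ≡⟨ ∑-allPairs _ ⟩
      ∑ (allFin n) (λ i → ∑ (allFin n) (λ j → ∑ (cellOf i j (i Fin.<? j)) (λ _ → 1ℤ)))
    ≡⟨ ∑-cong (allFin n) (λ i → ∑-cong (allFin n) (λ j → count-cell (i Fin.<? j))) ⟩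
      ∑ (allFin n) (λ i → ∑ (allFin n) (λ j → if does (i Fin.<? j) then 1ℤ else 0ℤ))
    ≡⟨ ∑-allFin-< n ⟩
      + (n C 2)
    ∎)
    where
    open ≡-Reasoning
    count-cell : ∀ {i j} (i<?j : Dec (i Fin.< j)) →
                 ∑ (cellOf i j i<?j) (λ _ → 1ℤ) ≡ (if does i<?j then 1ℤ else 0ℤ)
    count-cell (yes _) = refl
    count-cell (no _)  = refl

  -- Relabelling vertices

  ≮∧≯⇒≡ : ∀ {a b : Fin n} → ¬ a Fin.< b → ¬ b Fin.< a → a ≡ b
  ≮∧≯⇒≡ {a} {b} a≮b b≮a with Fin.<-cmp a b
  ... | tri< a<b _ _   = ⊥-elim (a≮b a<b)
  ... | tri≈ _ a≡b _   = a≡b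
  ... | tri> _ _ b<a   = ⊥-elim (b≮a b<a)

  pairOf : (a b : Fin n) → .(a ≢ b) → Pair n
  pairOf a b a≢b with Fin.<-cmp a b
  ... | tri< a<b _ _   = pair a b a<b
  ... | tri≈ _ a≡b _   = ⊥-elim-irr (a≢b a≡b)
  ... | tri> _ _ b<a   = pair b a b<a

  data Joins (p : Pair n) (a b : Fin n) : Set where
    forwards  : fst p ≡ a → snd p ≡ b → Joins p a b
    backwards : fst p ≡ b → snd p ≡ a → Joins p a b

  joins-sym : ∀ {p a b} → Joins p a b → Joins p b a
  joins-sym (forwards  p₁≡a p₂≡b) = backwards p₁≡a p₂≡b
  joins-sym (backwards p₁≡b p₂≡a) = forwards p₁≡b p₂≡a

  joins-pairOf : ∀ a b .(a≢b : a ≢ b) → Joins (pairOf a b a≢b) a b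
  joins-pairOf a b a≢b with Fin.<-cmp a b
  ... | tri< _ _ _     = forwards refl refl
  ... | tri≈ _ a≡b _   = ⊥-elim-irr (a≢b a≡b)
  ... | tri> _ _ _     = backwards refl refl

  joins-≢ : ∀ {p a b} → Joins p a b → a ≢ b
  joins-≢ {p} (forwards  refl refl) = Fin.<⇒≢ (lt p)
  joins-≢ {p} (backwards refl refl) = Fin.<⇒≢ (lt p) ∘ sym

  joins-unique : ∀ {p q a b} → Joins p a b → Joins q a b → p ≡ q
  joins-unique (forwards  p₁ p₂) (forwards  q₁ q₂) = pair-≡ (trans p₁ (sym q₁)) (trans p₂ (sym q₂))
  joins-unique (backwards p₁ p₂) (backwards q₁ q₂) = pair-≡ (trans p₁ (sym q₁)) (trans p₂ (sym q₂))
  joins-unique {p} {q} (forwards  refl refl) (backwards q₁ q₂) =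
    ⊥-elim (Fin.<-asym (lt p) (subst₂ Fin._<_ q₁ q₂ (lt q)))
  joins-unique {p} {q} (backwards refl refl) (forwards  q₁ q₂) =
    ⊥-elim (Fin.<-asym (lt p) (subst₂ Fin._<_ q₁ q₂ (lt q)))

  adj-joins : ∀ (K : Graph n) {p a b} → Joins p a b → adj K a b ≡ K p
  adj-joins K {a = a} {b} a~b with a Fin.<? b | b Fin.<? a
  ... | yes _   | _       = cong K (joins-unique (forwards refl refl) a~b)
  ... | no _    | yes _   = cong K (joins-unique (backwards refl refl) a~b)
  ... | no a≮b  | no b≮a  = ⊥-elim (joins-≢ a~b (≮∧≯⇒≡ a≮b b≮a))

  adj-irrefl : ∀ (K : Graph n) a → adj K a a ≡ false
  adj-irrefl K a with a Fin.<? a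
  ... | yes a<a = ⊥-elim (Fin.<-irrefl refl a<a)
  ... | no _    = refl

  relabel : Permutation′ n → Pair n → Pair n
  relabel σ p = pairOf (σ ⟨$⟩ʳ fst p) (σ ⟨$⟩ʳ snd p) (Fin.<⇒≢ (lt p) ∘ ⟨$⟩ʳ-injective)
    where
    ⟨$⟩ʳ-injective : ∀ {a b} → σ ⟨$⟩ʳ a ≡ σ ⟨$⟩ʳ b → a ≡ b
    ⟨$⟩ʳ-injective {a} {b} σa≡σb = trans (sym (inverseˡ σ)) (trans (cong (σ ⟨$⟩ˡ_) σa≡σb) (inverseˡ σ))

  joins-relabel : ∀ σ {q a b} → Joins q a b → Joins (relabel σ q) (σ ⟨$⟩ʳ a) (σ ⟨$⟩ʳ b)
  joins-relabel σ (forwards  refl refl) = joins-pairOf _ _ _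
  joins-relabel σ (backwards refl refl) = joins-sym (joins-pairOf _ _ _)

  relabel-id : ∀ p → relabel id p ≡ p
  relabel-id p = joins-unique (joins-relabel id {p} (forwards refl refl)) (forwards refl refl)

  relabel-inverse : ∀ σ p → relabel (flip σ) (relabel σ p) ≡ p
  relabel-inverse σ p =
    joins-unique (subst₂ (Joins _) (inverseˡ σ) (inverseˡ σ)
                         (joins-relabel (flip σ) (joins-relabel σ {p} (forwards refl refl))))
                 (forwards refl refl)

  relabel-injective : ∀ σ {p q} → relabel σ p ≡ relabel σ q → p ≡ q
  relabel-injective σ {p} {q} σp≡σq =
    trans (sym (relabel-inverse σ p)) (trans (cong (relabel (flip σ)) σp≡σq) (relabel-inverse σ q))

  samePair-relabel : ∀ σ p q → samePair (relabel σ p) (relabel σ q) ≡ samePair p q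
  samePair-relabel σ p q =
    does-⇔ (mk⇔ (relabel-injective σ) (cong (relabel σ))) (relabel σ p ≟ₚ relabel σ q) (p ≟ₚ q)

  ∑-allPairs-relabel : ∀ σ (h : Pair n → ℤ) → ∑ (allPairs n) h ≡ ∑ (allPairs n) (h ∘ relabel σ)
  ∑-allPairs-relabel σ h = begin
      ∑ (allPairs n) h
    ≡⟨ ∑-cong (allPairs n) (λ p → sym (∑-allPairs-δ (relabel (flip σ) p) (λ _ → h p))) ⟩
      ∑ (allPairs n) (λ p → ∑ (allPairs n) (λ q → if samePair q (relabel (flip σ) p) then h p else 0ℤ))
    ≡⟨ ∑-cong (allPairs n) (λ p → ∑-cong (allPairs n) λ q → cong (λ b → if b then h p else 0ℤ) (transpose p q)) ⟩
      ∑ (allPairs n) (λ p → ∑ (allPairs n) (λ q → if samePair p (relabel σ q) then h p else 0ℤ))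
    ≡⟨ ∑-comm (allPairs n) (allPairs n) _ ⟩
      ∑ (allPairs n) (λ q → ∑ (allPairs n) (λ p → if samePair p (relabel σ q) then h p else 0ℤ))
    ≡⟨ ∑-cong (allPairs n) (λ q → ∑-allPairs-δ (relabel σ q) h) ⟩
      ∑ (allPairs n) (h ∘ relabel σ)
    ∎
    where
    open ≡-Reasoning
    transpose : ∀ p q → samePair q (relabel (flip σ) p) ≡ samePair p (relabel σ q)
    transpose p q = does-⇔ (mk⇔ (λ q≡ → trans (sym (relabel-inverse (flip σ) p)) (cong (relabel σ) (sym q≡)))
                                (λ p≡ → trans (sym (relabel-inverse σ q)) (cong (relabel (flip σ)) (sym p≡))))
                           (q ≟ₚ relabel (flip σ) p) (p ≟ₚ relabel σ q)

  _≅⟨_⟩_ : Graph n → Permutation′ n → Graph n → Set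
  G ≅⟨ σ ⟩ H = ∀ i j → adj G i j ≡ adj H (σ ⟨$⟩ʳ i) (σ ⟨$⟩ʳ j)

  ≅⇒relabel : ∀ {G H : Graph n} {σ} → G ≅⟨ σ ⟩ H → ∀ p → G p ≡ H (relabel σ p)
  ≅⇒relabel {G} {H} {σ} G≅H p =
    trans (sym (adj-joins G (forwards refl refl)))
          (trans (G≅H (fst p) (snd p)) (adj-joins H (joins-relabel σ {p} (forwards refl refl))))

  relabel⇒≅ : ∀ {G H : Graph n} {σ} → (∀ p → G p ≡ H (relabel σ p)) → G ≅⟨ σ ⟩ H
  relabel⇒≅ {G} {H} {σ} G≡H∘σ i j with i Fin.≟ j
  ... | yes refl = trans (adj-irrefl G i) (sym (adj-irrefl H (σ ⟨$⟩ʳ i)))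
  ... | no i≢j   = trans (adj-joins G i~j) (trans (G≡H∘σ _) (sym (adj-joins H (joins-relabel σ i~j))))
    where
    i~j : Joins (pairOf i j i≢j) i j
    i~j = joins-pairOf i j i≢j

  ≗⇒≅ : ∀ {G H : Graph n} → (∀ p → G p ≡ H p) → G ≅ H
  ≗⇒≅ {G} {H} G≗H = id , relabel⇒≅ {G} {H} {id} (λ p → trans (G≗H p) (cong H (sym (relabel-id p))))

  ≅-refl : ∀ {G : Graph n} → G ≅ G
  ≅-refl = ≗⇒≅ (λ _ → refl)

  ≅-sym : ∀ {G H : Graph n} → G ≅ H → H ≅ G
  ≅-sym {G} {H} (σ , G≅H) =
    flip σ , λ i j → sym (trans (G≅H (σ ⟨$⟩ˡ i) (σ ⟨$⟩ˡ j)) (cong₂ (adj H) (inverseʳ σ) (inverseʳ σ)))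

  ≅-trans : ∀ {G H K : Graph n} → G ≅ H → H ≅ K → G ≅ K
  ≅-trans (σ , G≅H) (τ , H≅K) = σ ∘ₚ τ , λ i j → trans (G≅H i j) (H≅K _ _)

  ⊕-relabel : ∀ {G H : Graph n} {σ} → G ≅⟨ σ ⟩ H → ∀ f → (G ⊕ f) ≅⟨ σ ⟩ (H ⊕ relabel σ f)
  ⊕-relabel {G} {H} {σ} G≅H f = relabel⇒≅ {G ⊕ f} {H ⊕ relabel σ f} {σ} λ p →
    cong₂ (λ b x → if b then true else x) (sym (samePair-relabel σ p f)) (≅⇒relabel {G} {H} {σ} G≅H p)

  ─-relabel : ∀ {G H : Graph n} {σ} → G ≅⟨ σ ⟩ H → ∀ e → (G ─ e) ≅⟨ σ ⟩ (H ─ relabel σ e)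
  ─-relabel {G} {H} {σ} G≅H e = relabel⇒≅ {G ─ e} {H ─ relabel σ e} {σ} λ p →
    cong₂ (λ x b → x ∧ not b) (≅⇒relabel {G} {H} {σ} G≅H p) (sym (samePair-relabel σ p e))

  ∑ₚ : (Pair n → Bool) → (Pair n → ℤ) → ℤ
  ∑ₚ B g = ∑ (allPairs n) (λ p → if B p then g p else 0ℤ)

  ∑-edges : ∀ (G : Graph n) (g : Pair n → ℤ) → ∑ (edges G) g ≡ ∑ₚ G g
  ∑-edges G g = trans (∑-filter _ (allPairs n) g) (∑-cong (allPairs n) λ p → selects (G p))
    where
    selects : ∀ b {x} → (if does (b Bool.≟ true) then x else 0ℤ) ≡ (if b then x else 0ℤ)
    selects true  = refl
    selects false = refl

  ∑-nonEdges : ∀ (G : Graph n) (g : Pair n → ℤ) → ∑ (nonEdges G) g ≡ ∑ₚ (not ∘ G) g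
  ∑-nonEdges G g = trans (∑-filter _ (allPairs n) g) (∑-cong (allPairs n) λ p → selects (G p))
    where
    selects : ∀ b {x} → (if does (b Bool.≟ false) then x else 0ℤ) ≡ (if not b then x else 0ℤ)
    selects true  = refl
    selects false = refl

  ∑ₚ-cong : ∀ B {g h : Pair n → ℤ} → (∀ p → B p ≡ true → g p ≡ h p) → ∑ₚ B g ≡ ∑ₚ B h
  ∑ₚ-cong B {g} {h} g≗h = ∑-cong (allPairs n) on
    where
    on : ∀ p → (if B p then g p else 0ℤ) ≡ (if B p then h p else 0ℤ)
    on p with B p in Bp
    ... | true  = g≗h p Bp
    ... | false = refl

  ∑ₚ-distrib-+ : ∀ B (g h : Pair n → ℤ) → ∑ₚ B (λ p → g p + h p) ≡ ∑ₚ B g + ∑ₚ B h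
  ∑ₚ-distrib-+ B g h = trans (∑-cong (allPairs n) λ p → split (B p)) (∑-distrib-+ (allPairs n) _ _)
    where
    split : ∀ b {x y} → (if b then x + y else 0ℤ) ≡ (if b then x else 0ℤ) + (if b then y else 0ℤ)
    split true  = refl
    split false = refl

  ∑ₚ-comm : ∀ B A′ (h : Pair n → Pair n → ℤ) →
            ∑ₚ B (λ p → ∑ₚ A′ (h p)) ≡ ∑ₚ A′ (λ q → ∑ₚ B (λ p → h p q))
  ∑ₚ-comm B A′ h = begin
      ∑ₚ B (λ p → ∑ₚ A′ (h p))
    ≡⟨ ∑-cong (allPairs n) (λ p → if-∑ (B p)) ⟩
      ∑ (allPairs n) (λ p → ∑ (allPairs n) (λ q → if B p then (if A′ q then h p q else 0ℤ) else 0ℤ))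
    ≡⟨ ∑-comm (allPairs n) (allPairs n) _ ⟩
      ∑ (allPairs n) (λ q → ∑ (allPairs n) (λ p → if B p then (if A′ q then h p q else 0ℤ) else 0ℤ))
    ≡⟨ ∑-cong (allPairs n) (λ q → ∑-cong (allPairs n) (λ p → if-comm (B p) (A′ q))) ⟩
      ∑ (allPairs n) (λ q → ∑ (allPairs n) (λ p → if A′ q then (if B p then h p q else 0ℤ) else 0ℤ))
    ≡⟨ sym (∑-cong (allPairs n) (λ q → if-∑ (A′ q))) ⟩
      ∑ₚ A′ (λ q → ∑ₚ B (λ p → h p q))
    ∎
    where
    open ≡-Reasoning
    if-∑ : ∀ b {f : Pair n → ℤ} →
           (if b then ∑ (allPairs n) f else 0ℤ) ≡ ∑ (allPairs n) (λ q → if b then f q else 0ℤ)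
    if-∑ true  = refl
    if-∑ false = sym (∑-zero (allPairs n))
    if-comm : ∀ b c {x} → (if b then (if c then x else 0ℤ) else 0ℤ) ≡ (if c then (if b then x else 0ℤ) else 0ℤ)
    if-comm true  c     = refl
    if-comm false true  = refl
    if-comm false false = refl

  ∑ₚ-complement : ∀ B (g : Pair n → ℤ) → ∑ₚ B g + ∑ₚ (not ∘ B) g ≡ ∑ (allPairs n) g
  ∑ₚ-complement B g = trans (sym (∑-distrib-+ (allPairs n) _ _)) (∑-cong (allPairs n) λ p → split (B p))
    where
    split : ∀ b {x} → (if b then x else 0ℤ) + (if not b then x else 0ℤ) ≡ x
    split true  = ℤ.+-identityʳ _
    split false = ℤ.+-identityˡ _

  ∑ₚ-insert : ∀ {B′ B} e → B e ≡ false → (∀ p → B′ p ≡ samePair p e ∨ B p) →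
              ∀ g → ∑ₚ B′ g ≡ g e + ∑ₚ B g
  ∑ₚ-insert {B′} {B} e Be≡false B′≡e∨B g = begin
      ∑ₚ B′ g
    ≡⟨ ∑-cong (allPairs n) split ⟩
      ∑ (allPairs n) (λ p → (if samePair p e then g p else 0ℤ) + (if B p then g p else 0ℤ))
    ≡⟨ ∑-distrib-+ (allPairs n) _ _ ⟩
      ∑ (allPairs n) (λ p → if samePair p e then g p else 0ℤ) + ∑ₚ B g
    ≡⟨ cong (_+ ∑ₚ B g) (∑-allPairs-δ e g) ⟩
      g e + ∑ₚ B g
    ∎
    where
    open ≡-Reasoning
    split : ∀ p → (if B′ p then g p else 0ℤ) ≡ (if samePair p e then g p else 0ℤ) + (if B p then g p else 0ℤ)
    split p rewrite B′≡e∨B p with samePair p e in p~e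
    ... | true rewrite samePair⇒≡ {p} {e} p~e | Be≡false = sym (ℤ.+-identityʳ (g e))
    ... | false = sym (ℤ.+-identityˡ _)

  ∑ₚ-⊕ : ∀ {G : Graph n} {f} → G f ≡ false → ∀ g → ∑ₚ (G ⊕ f) g ≡ g f + ∑ₚ G g
  ∑ₚ-⊕ {G} {f} Gf = ∑ₚ-insert f Gf ⊕≡∨
    where
    ⊕≡∨ : ∀ p → (G ⊕ f) p ≡ samePair p f ∨ G p
    ⊕≡∨ p with samePair p f
    ... | true  = refl
    ... | false = refl

  ∑ₚ-─ : ∀ {G : Graph n} {e} → G e ≡ true → ∀ g → ∑ₚ G g ≡ g e + ∑ₚ (G ─ e) g
  ∑ₚ-─ {G} {e} Ge = ∑ₚ-insert e ─-at-e restore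
    where
    ─-at-e : (G ─ e) e ≡ false
    ─-at-e = trans (cong (λ b → G e ∧ not b) (samePair-refl e)) (Bool.∧-zeroʳ (G e))
    restore : ∀ p → G p ≡ samePair p e ∨ (G ─ e) p
    restore p with samePair p e in p~e
    ... | true  = trans (cong G (samePair⇒≡ p~e)) Ge
    ... | false = sym (Bool.∧-identityʳ (G p))

  ∑ₚ-not-─ : ∀ {G : Graph n} {e} → G e ≡ true →
             ∀ g → ∑ₚ (not ∘ (G ─ e)) g ≡ g e + ∑ₚ (not ∘ G) g
  ∑ₚ-not-─ {G} {e} Ge = ∑ₚ-insert e (cong not Ge) complement
    where
    complement : ∀ p → not ((G ─ e) p) ≡ samePair p e ∨ not (G p)
    complement p with samePair p e
    ... | true  = cong not (Bool.∧-zeroʳ (G p))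
    ... | false = cong not (Bool.∧-identityʳ (G p))

  ∑ₚ-const : ∀ (G : Graph n) c → ∑ₚ G (λ _ → c) ≡ + ∥ G ∥ ℤ.* c
  ∑ₚ-const G c = trans (sym (∑-edges G _)) (∑-const (edges G) c)

  ∑ₚ-not-const : ∀ (G : Graph n) c → ∑ₚ (not ∘ G) (λ _ → c) ≡ + (n C 2) ℤ.* c - + ∥ G ∥ ℤ.* c
  ∑ₚ-not-const G c = begin
      ∑ₚ (not ∘ G) (λ _ → c)
    ≡⟨ add-sub (∑ₚ G (λ _ → c)) _ ⟩
      ∑ₚ G (λ _ → c) + ∑ₚ (not ∘ G) (λ _ → c) - ∑ₚ G (λ _ → c)
    ≡⟨ cong₂ _-_ (trans (∑ₚ-complement G _)
                        (trans (∑-const (allPairs n) c) (cong (λ k → + k ℤ.* c) length-allPairs)))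
                 (∑ₚ-const G c) ⟩
      + (n C 2) ℤ.* c - + ∥ G ∥ ℤ.* c
    ∎
    where
    open ≡-Reasoning
    add-sub : ∀ a b → b ≡ a + b - a
    add-sub = solve-∀

  ∥∥≡∑ₚ : ∀ (G : Graph n) → + ∥ G ∥ ≡ ∑ₚ G (λ _ → 1ℤ)
  ∥∥≡∑ₚ G = trans (sym (∑-1 (edges G))) (∑-edges G _)

  ∥⊕∥ : ∀ {G : Graph n} {f} → G f ≡ false → ∥ G ⊕ f ∥ ≡ suc ∥ G ∥
  ∥⊕∥ {G} {f} Gf = ℤ.+-injective
    (trans (∥∥≡∑ₚ (G ⊕ f)) (trans (∑ₚ-⊕ {G} {f} Gf (λ _ → 1ℤ)) (cong (_+_ 1ℤ) (sym (∥∥≡∑ₚ G)))))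

  ∥─∥ : ∀ {G : Graph n} {e} → G e ≡ true → ∥ G ∥ ≡ suc ∥ G ─ e ∥
  ∥─∥ {G} {e} Ge = ℤ.+-injective
    (trans (∥∥≡∑ₚ G) (trans (∑ₚ-─ {G} {e} Ge (λ _ → 1ℤ)) (cong (_+_ 1ℤ) (sym (∥∥≡∑ₚ (G ─ e))))))

  ∥∥≤ : ∀ (G : Graph n) → ∥ G ∥ ≤ n C 2
  ∥∥≤ G = subst (∥ G ∥ ≤_) length-allPairs (List.length-filter _ (allPairs n))

  extensions : Graph n → List (Graph n)
  extensions G = map (G ⊕_) (nonEdges G)

  ∥extensions∥ : ∀ (G : Graph n) → All (λ H → ∥ H ∥ ≡ suc ∥ G ∥) (extensions G)
  ∥extensions∥ G = All.map⁺ (All.map (∥⊕∥ {G}) (All.all-filter _ (allPairs n)))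

  ∥ED1∥ : ∀ (G : Graph n) → All (λ H → suc ∥ H ∥ ≡ ∥ G ∥) (ED1 G)
  ∥ED1∥ G = All.map⁺ (All.map (sym ∘ ∥─∥ {G}) (All.all-filter _ (allPairs n)))

  ∥MD1∥ : ∀ (G : Graph n) → All (λ H → ∥ H ∥ ≡ ∥ G ∥) (MD1 G)
  ∥MD1∥ G = All.concat⁺ (All.map⁺ (All.map extensions-of-deletion (All.all-filter _ (allPairs n))))
    where
    extensions-of-deletion : ∀ {e} → G e ≡ true → All (λ H → ∥ H ∥ ≡ ∥ G ∥) (extensions (G ─ e))
    extensions-of-deletion Ge = All.map (λ ∥H∥≡ → trans ∥H∥≡ (sym (∥─∥ {G} Ge))) (∥extensions∥ _)

  open UpDown (∥_∥ {n}) (n C 2) extensions (ED1 {n}) ∥∥≤ ∥extensions∥ public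

  -- Invariant test functions and the commutation relation

  Invariant : (Graph n → ℤ) → Set
  Invariant ψ = ψ Preserves _≅_ ⟶ _≡_

  U-via-∑ₚ : ∀ ψ (G : Graph n) → U ψ G ≡ ∑ₚ (not ∘ G) (λ f → ψ (G ⊕ f))
  U-via-∑ₚ ψ G = trans (∑-map (G ⊕_) (nonEdges G) ψ) (∑-nonEdges G _)

  D-via-∑ₚ : ∀ ψ (G : Graph n) → D ψ G ≡ ∑ₚ G (λ e → ψ (G ─ e))
  D-via-∑ₚ ψ G = trans (∑-map (G ─_) (edges G) ψ) (∑-edges G _)

  U-invariant : ∀ {ψ} → Invariant ψ → Invariant (U ψ)
  U-invariant {ψ} ψ-inv {G} {H} (σ , G≅H) = begin
      U ψ G
    ≡⟨ U-via-∑ₚ ψ G ⟩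
      ∑ₚ (not ∘ G) (λ f → ψ (G ⊕ f))
    ≡⟨ ∑-cong (allPairs n) (λ f → cong₂ (λ b x → if not b then x else 0ℤ)
                                        (≅⇒relabel {G} {H} {σ} G≅H f) (ψ-inv (σ , ⊕-relabel {G} {H} {σ} G≅H f))) ⟩
      ∑ₚ (not ∘ H ∘ relabel σ) (λ f → ψ (H ⊕ relabel σ f))
    ≡⟨ sym (∑-allPairs-relabel σ _) ⟩
      ∑ₚ (not ∘ H) (λ f → ψ (H ⊕ f))
    ≡⟨ sym (U-via-∑ₚ ψ H) ⟩
      U ψ H
    ∎
    where open ≡-Reasoning

  D-invariant : ∀ {ψ} → Invariant ψ → Invariant (D ψ)
  D-invariant {ψ} ψ-inv {G} {H} (σ , G≅H) = begin
      D ψ G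
    ≡⟨ D-via-∑ₚ ψ G ⟩
      ∑ₚ G (λ e → ψ (G ─ e))
    ≡⟨ ∑-cong (allPairs n) (λ e → cong₂ (λ b x → if b then x else 0ℤ)
                                        (≅⇒relabel {G} {H} {σ} G≅H e) (ψ-inv (σ , ─-relabel {G} {H} {σ} G≅H e))) ⟩
      ∑ₚ (H ∘ relabel σ) (λ e → ψ (H ─ relabel σ e))
    ≡⟨ sym (∑-allPairs-relabel σ _) ⟩
      ∑ₚ H (λ e → ψ (H ─ e))
    ≡⟨ sym (D-via-∑ₚ ψ H) ⟩
      D ψ H
    ∎
    where open ≡-Reasoning

  ─⊕-cancel : ∀ {G : Graph n} {e} → G e ≡ true → ∀ p → ((G ─ e) ⊕ e) p ≡ G p
  ─⊕-cancel {G} {e} Ge p with samePair p e in p~e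
  ... | true  = sym (trans (cong G (samePair⇒≡ {p} {e} p~e)) Ge)
  ... | false = Bool.∧-identityʳ (G p)

  ⊕─-cancel : ∀ {G : Graph n} {f} → G f ≡ false → ∀ p → ((G ⊕ f) ─ f) p ≡ G p
  ⊕─-cancel {G} {f} Gf p with samePair p f in p~f
  ... | true  = sym (trans (cong G (samePair⇒≡ {p} {f} p~f)) Gf)
  ... | false = Bool.∧-identityʳ (G p)

  ─⊕-comm : ∀ {G : Graph n} {e f} → e ≢ f → ∀ p → ((G ─ e) ⊕ f) p ≡ ((G ⊕ f) ─ e) p
  ─⊕-comm {G} {e} {f} e≢f p with samePair p f in p~f
  ... | true rewrite samePair⇒≡ {p} {f} p~f = sym (cong not (dec-false (f ≟ₚ e) (e≢f ∘ sym)))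
  ... | false = refl

  DU-expansion : ∀ {ψ} → Invariant ψ → ∀ (G : Graph n) →
    D (U ψ) G ≡ ∑ₚ G (λ _ → ψ G) + ∑ₚ G (λ e → ∑ₚ (not ∘ G) (λ f → ψ ((G ─ e) ⊕ f)))
  DU-expansion {ψ} ψ-inv G = begin
      D (U ψ) G
    ≡⟨ D-via-∑ₚ (U ψ) G ⟩
      ∑ₚ G (λ e → U ψ (G ─ e))
    ≡⟨ ∑ₚ-cong G at-edge ⟩
      ∑ₚ G (λ e → ψ G + ∑ₚ (not ∘ G) (λ f → ψ ((G ─ e) ⊕ f)))
    ≡⟨ ∑ₚ-distrib-+ G _ _ ⟩
      ∑ₚ G (λ _ → ψ G) + ∑ₚ G (λ e → ∑ₚ (not ∘ G) (λ f → ψ ((G ─ e) ⊕ f)))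
    ∎
    where
    open ≡-Reasoning
    at-edge : ∀ e → G e ≡ true → U ψ (G ─ e) ≡ ψ G + ∑ₚ (not ∘ G) (λ f → ψ ((G ─ e) ⊕ f))
    at-edge e Ge = begin
        U ψ (G ─ e)
      ≡⟨ U-via-∑ₚ ψ (G ─ e) ⟩
        ∑ₚ (not ∘ (G ─ e)) (λ f → ψ ((G ─ e) ⊕ f))
      ≡⟨ ∑ₚ-not-─ {G} {e} Ge _ ⟩
        ψ ((G ─ e) ⊕ e) + ∑ₚ (not ∘ G) (λ f → ψ ((G ─ e) ⊕ f))
      ≡⟨ cong (_+ ∑ₚ (not ∘ G) (λ f → ψ ((G ─ e) ⊕ f))) (ψ-inv (≗⇒≅ (─⊕-cancel {G} {e} Ge))) ⟩
        ψ G + ∑ₚ (not ∘ G) (λ f → ψ ((G ─ e) ⊕ f))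
      ∎

  UD-expansion : ∀ {ψ} → Invariant ψ → ∀ (G : Graph n) →
    U (D ψ) G ≡ ∑ₚ (not ∘ G) (λ _ → ψ G) + ∑ₚ (not ∘ G) (λ f → ∑ₚ G (λ e → ψ ((G ⊕ f) ─ e)))
  UD-expansion {ψ} ψ-inv G = begin
      U (D ψ) G
    ≡⟨ U-via-∑ₚ (D ψ) G ⟩
      ∑ₚ (not ∘ G) (λ f → D ψ (G ⊕ f))
    ≡⟨ ∑ₚ-cong (not ∘ G) (λ f ¬Gf → at-nonEdge f (Bool.not-injective ¬Gf)) ⟩
      ∑ₚ (not ∘ G) (λ f → ψ G + ∑ₚ G (λ e → ψ ((G ⊕ f) ─ e)))
    ≡⟨ ∑ₚ-distrib-+ (not ∘ G) _ _ ⟩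
      ∑ₚ (not ∘ G) (λ _ → ψ G) + ∑ₚ (not ∘ G) (λ f → ∑ₚ G (λ e → ψ ((G ⊕ f) ─ e)))
    ∎
    where
    open ≡-Reasoning
    at-nonEdge : ∀ f → G f ≡ false → D ψ (G ⊕ f) ≡ ψ G + ∑ₚ G (λ e → ψ ((G ⊕ f) ─ e))
    at-nonEdge f Gf = begin
        D ψ (G ⊕ f)
      ≡⟨ D-via-∑ₚ ψ (G ⊕ f) ⟩
        ∑ₚ (G ⊕ f) (λ e → ψ ((G ⊕ f) ─ e))
      ≡⟨ ∑ₚ-⊕ {G} {f} Gf _ ⟩
        ψ ((G ⊕ f) ─ f) + ∑ₚ G (λ e → ψ ((G ⊕ f) ─ e))
      ≡⟨ cong (_+ ∑ₚ G (λ e → ψ ((G ⊕ f) ─ e))) (ψ-inv (≗⇒≅ (⊕─-cancel {G} {f} Gf))) ⟩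
        ψ G + ∑ₚ G (λ e → ψ ((G ⊕ f) ─ e))
      ∎

  exchange : ∀ {ψ} → Invariant ψ → ∀ (G : Graph n) →
    ∑ₚ G (λ e → ∑ₚ (not ∘ G) (λ f → ψ ((G ─ e) ⊕ f))) ≡
    ∑ₚ (not ∘ G) (λ f → ∑ₚ G (λ e → ψ ((G ⊕ f) ─ e)))
  exchange {ψ} ψ-inv G =
    trans (∑ₚ-cong G λ e Ge → ∑ₚ-cong (not ∘ G) λ f ¬Gf →
             ψ-inv (≗⇒≅ (─⊕-comm {G} {e} {f} (edge≢nonEdge Ge ¬Gf))))
          (∑ₚ-comm G (not ∘ G) _)
    where
    edge≢nonEdge : ∀ {e f} → G e ≡ true → not (G f) ≡ true → e ≢ f
    edge≢nonEdge Ge ¬Ge refl with trans (sym Ge) (Bool.not-injective ¬Ge)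
    ... | ()

  DU≡UD+weight : ∀ {ψ} → Invariant ψ → ∀ (G : Graph n) → D (U ψ) G ≡ U (D ψ) G + weight ∥ G ∥ ℤ.* ψ G
  DU≡UD+weight {ψ} ψ-inv G = begin
      D (U ψ) G
    ≡⟨ DU-expansion ψ-inv G ⟩
      ∑ₚ G (λ _ → ψ G) + T
    ≡⟨ cong₂ _+_ (∑ₚ-const G (ψ G)) (exchange ψ-inv G) ⟩
      + ∥ G ∥ ℤ.* ψ G + T′
    ≡⟨ rearrange (+ ∥ G ∥) (+ (n C 2)) (ψ G) T′ ⟩
      (+ (n C 2) ℤ.* ψ G - + ∥ G ∥ ℤ.* ψ G + T′) + (+ ∥ G ∥ + + ∥ G ∥ - + (n C 2)) ℤ.* ψ G
    ≡⟨ cong₂ _+_ (cong (_+ T′) (sym (∑ₚ-not-const G (ψ G)))) (cong (ℤ._* ψ G) (sym (weight≡ ∥ G ∥))) ⟩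
      (∑ₚ (not ∘ G) (λ _ → ψ G) + T′) + weight ∥ G ∥ ℤ.* ψ G
    ≡⟨ cong (_+ weight ∥ G ∥ ℤ.* ψ G) (sym (UD-expansion ψ-inv G)) ⟩
      U (D ψ) G + weight ∥ G ∥ ℤ.* ψ G
    ∎
    where
    open ≡-Reasoning
    T T′ : ℤ
    T  = ∑ₚ G (λ e → ∑ₚ (not ∘ G) (λ f → ψ ((G ─ e) ⊕ f)))
    T′ = ∑ₚ (not ∘ G) (λ f → ∑ₚ G (λ e → ψ ((G ⊕ f) ─ e)))
    rearrange : ∀ k N x t → k ℤ.* x + t ≡ (N ℤ.* x - k ℤ.* x + t) + (k + k - N) ℤ.* x
    rearrange = solve-∀

  open Commuting Invariant U-invariant D-invariant DU≡UD+weight public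

-- Counting isomorphism classes

module Counting (S : DecSetoid 0ℓ 0ℓ) where

  open DecSetoid S using (Carrier; _≈_; _≟_) renaming (refl to ≈-refl; sym to ≈-sym; trans to ≈-trans)

  count : Carrier → List Carrier → ℕ
  count a xs = length (filter (_≟ a) xs)

  _≉?_ : ∀ x a → Dec (¬ x ≈ a)
  x ≉? a = ¬? (x ≟ a)

  removeClass : Carrier → List Carrier → List Carrier
  removeClass a = filter (_≉? a)

  indicator : Carrier → Carrier → ℤ
  indicator a x = if does (x ≟ a) then 1ℤ else 0ℤ

  indicator-invariant : ∀ a → indicator a Preserves _≈_ ⟶ _≡_
  indicator-invariant a {x} {y} x≈y with x ≟ a | y ≟ a
  ... | yes _   | yes _   = refl
  ... | no _    | no _    = refl
  ... | yes x≈a | no y≉a  = ⊥-elim (y≉a (≈-trans (≈-sym x≈y) x≈a))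
  ... | no x≉a  | yes y≈a = ⊥-elim (x≉a (≈-trans x≈y y≈a))

  ∑-indicator : ∀ a xs → ∑ xs (indicator a) ≡ + count a xs
  ∑-indicator a xs = trans (sym (∑-filter (_≟ a) xs (λ _ → 1ℤ))) (∑-1 (filter (_≟ a) xs))

  count-concatMap : ∀ a (f : B → List Carrier) xs → count a (concatMap f xs) ≡ sum (map (λ x → count a (f x)) xs)
  count-concatMap a f []       = refl
  count-concatMap a f (x ∷ xs) = begin
      length (filter (_≟ a) (f x ++ concatMap f xs))
    ≡⟨ cong length (List.filter-++ (_≟ a) (f x) (concatMap f xs)) ⟩
      length (filter (_≟ a) (f x) ++ filter (_≟ a) (concatMap f xs))
    ≡⟨ List.length-++ (filter (_≟ a) (f x)) ⟩
      count a (f x) ℕ.+ count a (concatMap f xs)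
    ≡⟨ cong (count a (f x) ℕ.+_) (count-concatMap a f xs) ⟩
      count a (f x) ℕ.+ sum (map (λ x → count a (f x)) xs)
    ∎
    where open ≡-Reasoning

  count-removeClass-≈ : ∀ {a b} → b ≈ a → ∀ xs → count b (removeClass a xs) ≡ 0
  count-removeClass-≈ b≈a []       = refl
  count-removeClass-≈ {a} {b} b≈a (x ∷ xs) with x ≟ a
  ... | yes _   = count-removeClass-≈ b≈a xs
  ... | no x≉a with x ≟ b
  ...   | yes x≈b = ⊥-elim (x≉a (≈-trans x≈b b≈a))
  ...   | no _    = count-removeClass-≈ b≈a xs

  count-removeClass-≉ : ∀ {a b} → ¬ b ≈ a → ∀ xs → count b (removeClass a xs) ≡ count b xs
  count-removeClass-≉ b≉a []       = refl
  count-removeClass-≉ {a} {b} b≉a (x ∷ xs) with x ≟ a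
  ... | yes x≈a with x ≟ b
  ...   | yes x≈b = ⊥-elim (b≉a (≈-trans (≈-sym x≈b) x≈a))
  ...   | no _    = count-removeClass-≉ b≉a xs
  count-removeClass-≉ {a} {b} b≉a (x ∷ xs) | no _ with x ≟ b
  ...   | yes _ = cong suc (count-removeClass-≉ b≉a xs)
  ...   | no _  = count-removeClass-≉ b≉a xs

  ∑-split-class : ∀ {ψ} → ψ Preserves _≈_ ⟶ _≡_ → ∀ a xs →
                  ∑ xs ψ ≡ + count a xs ℤ.* ψ a + ∑ (removeClass a xs) ψ
  ∑-split-class ψ-inv a []       = refl
  ∑-split-class {ψ} ψ-inv a (x ∷ xs) with x ≟ a
  ... | yes x≈a =
    trans (cong₂ _+_ (ψ-inv x≈a) (∑-split-class ψ-inv a xs)) (absorb (ψ a) (+ count a xs) (∑ (removeClass a xs) ψ))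
    where
    absorb : ∀ u c r → u + (c ℤ.* u + r) ≡ (1ℤ + c) ℤ.* u + r
    absorb = solve-∀
  ... | no _    =
    trans (cong (_+_ (ψ x)) (∑-split-class ψ-inv a xs)) (swap-front (ψ x) (+ count a xs ℤ.* ψ a) (∑ (removeClass a xs) ψ))
    where
    swap-front : ∀ u c r → u + (c + r) ≡ c + (u + r)
    swap-front = solve-∀

  ∑-determined-by-counts : ∀ {q} (Q : Carrier → Set q) {xs ys} → All Q xs → All Q ys →
    (∀ a → Q a → count a xs ≡ count a ys) →
    ∀ {ψ} → ψ Preserves _≈_ ⟶ _≡_ → ∑ xs ψ ≡ ∑ ys ψ
  ∑-determined-by-counts Q {xs} Qxs Qys same {ψ} ψ-inv = by-length (length xs) ℕ.≤-refl Qxs Qys same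
    where
    by-length : ∀ k {xs ys} → length xs ≤ k → All Q xs → All Q ys →
                (∀ a → Q a → count a xs ≡ count a ys) → ∑ xs ψ ≡ ∑ ys ψ
    by-length _ {[]} {[]} _ _ _ _ = refl
    by-length _ {[]} {y ∷ ys} _ _ (Qy ∷ _) same =
      ⊥-elim (ℕ.0≢1+n (trans (same y Qy) (cong length (List.filter-accept (_≟ y) ≈-refl))))
    by-length (suc k) {x ∷ xs} {ys} (ℕ.s≤s |xs|≤k) (Qx ∷ Qxs) Qys same = begin
        ∑ (x ∷ xs) ψ
      ≡⟨ ∑-split-class ψ-inv x (x ∷ xs) ⟩
        + count x (x ∷ xs) ℤ.* ψ x + ∑ (removeClass x (x ∷ xs)) ψ
      ≡⟨ cong₂ (λ c s → + c ℤ.* ψ x + s) (same x Qx)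
               (by-length k shorter (All.filter⁺ (_≉? x) (Qx ∷ Qxs)) (All.filter⁺ (_≉? x) Qys) same-outside) ⟩
        + count x ys ℤ.* ψ x + ∑ (removeClass x ys) ψ
      ≡⟨ sym (∑-split-class ψ-inv x ys) ⟩
        ∑ ys ψ
      ∎
      where
      open ≡-Reasoning
      shorter : length (removeClass x (x ∷ xs)) ≤ k
      shorter = subst (λ zs → length zs ≤ k) (sym (List.filter-reject (_≉? x) (λ x≉x → x≉x ≈-refl)))
                      (ℕ.≤-trans (List.length-filter (_≉? x) xs) |xs|≤k)
      same-outside : ∀ a → Q a → count a (removeClass x (x ∷ xs)) ≡ count a (removeClass x ys)
      same-outside a Qa with a ≟ x
      ... | yes a≈x = trans (count-removeClass-≈ a≈x (x ∷ xs)) (sym (count-removeClass-≈ a≈x ys))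
      ... | no a≉x  = trans (count-removeClass-≉ a≉x (x ∷ xs))
                            (trans (same a Qa) (sym (count-removeClass-≉ a≉x ys)))

≅-decSetoid : ∀ {n} → IsoDec n → DecSetoid 0ℓ 0ℓ
≅-decSetoid {n} iso? = record
  { Carrier          = Graph n
  ; _≈_              = _≅_
  ; isDecEquivalence = record
    { isEquivalence = record { refl = ≅-refl ; sym = ≅-sym ; trans = ≅-trans }
    ; _≟_           = iso?
    }
  }

module _ {n : ℕ} (iso? : IsoDec n) where

  open Counting (≅-decSetoid iso?)

  deckMatrix : (Graph n → List (Graph n)) → Graph n → Graph n → ℕ
  deckMatrix deck H G = countIso iso? H (deck G)

  deck-counts⇒sums : ∀ (deck : Graph n → List (Graph n)) {r P Q} →
    All (All (λ H → ∥ H ∥ ≡ r) ∘ deck) P → All (All (λ H → ∥ H ∥ ≡ r) ∘ deck) Q →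
    (∀ H → ∥ H ∥ ≡ r → (deckMatrix deck ·X P) H ≡ (deckMatrix deck ·X Q) H) →
    ∀ {ψ} → Invariant ψ → ∑ P (λ G → ∑ (deck G) ψ) ≡ ∑ Q (λ G → ∑ (deck G) ψ)
  deck-counts⇒sums deck {r} {P} {Q} ranksP ranksQ same {ψ} ψ-inv = begin
      ∑ P (λ G → ∑ (deck G) ψ)
    ≡⟨ sym (∑-concatMap deck P ψ) ⟩
      ∑ (concatMap deck P) ψ
    ≡⟨ ∑-determined-by-counts (λ H → ∥ H ∥ ≡ r) (All.concat⁺ (All.map⁺ ranksP)) (All.concat⁺ (All.map⁺ ranksQ))
                              same-counts ψ-inv ⟩
      ∑ (concatMap deck Q) ψ
    ≡⟨ ∑-concatMap deck Q ψ ⟩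
      ∑ Q (λ G → ∑ (deck G) ψ)
    ∎
    where
    open ≡-Reasoning
    same-counts : ∀ H → ∥ H ∥ ≡ r → count H (concatMap deck P) ≡ count H (concatMap deck Q)
    same-counts H ∥H∥≡r = trans (count-concatMap H deck P) (trans (same H ∥H∥≡r) (sym (count-concatMap H deck Q)))

  ∑-MD1 : ∀ ψ (G : Graph n) → ∑ (MD1 G) ψ ≡ D (U ψ) G
  ∑-MD1 ψ G = trans (∑-concatMap _ (edges G) ψ) (sym (∑-map (G ─_) (edges G) (U ψ)))

  deck-agreement⇒DU-agreement : ∀ {m P Q} → All (λ G → ∥ G ∥ ≡ m) P → All (λ G → ∥ G ∥ ≡ m) Q →
    ((∀ H → ∥ H ∥ ≡ m ∸ 1 → (d1 iso? ·X P) H ≡ (d1 iso? ·X Q) H)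
      ⊎ (∀ H → ∥ H ∥ ≡ m → (Δ1 iso? ·X P) H ≡ (Δ1 iso? ·X Q) H)) →
    ∀ {ψ} → Invariant ψ → ∑ P (D (U ψ)) ≡ ∑ Q (D (U ψ))
  deck-agreement⇒DU-agreement rankP rankQ (inj₁ d1-agree) ψ-inv =
    deck-counts⇒sums ED1 (All.map ED1-ranks rankP) (All.map ED1-ranks rankQ) d1-agree (U-invariant ψ-inv)
    where
    ED1-ranks : ∀ {m} {G : Graph n} → ∥ G ∥ ≡ m → All (λ H → ∥ H ∥ ≡ m ∸ 1) (ED1 G)
    ED1-ranks ∥G∥≡m = All.map (λ ∥H∥+1≡ → cong (_∸ 1) (trans ∥H∥+1≡ ∥G∥≡m)) (∥ED1∥ _)
  deck-agreement⇒DU-agreement {P = P} {Q} rankP rankQ (inj₂ Δ1-agree) {ψ} ψ-inv =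
    trans (sym (∑-cong P (∑-MD1 ψ)))
          (trans (deck-counts⇒sums MD1 (All.map MD1-ranks rankP) (All.map MD1-ranks rankQ) Δ1-agree ψ-inv)
                 (∑-cong Q (∑-MD1 ψ)))
    where
    MD1-ranks : ∀ {m} {G : Graph n} → ∥ G ∥ ≡ m → All (λ H → ∥ H ∥ ≡ m) (MD1 G)
    MD1-ranks ∥G∥≡m = All.map (λ ∥H∥≡ → trans ∥H∥≡ ∥G∥≡m) (∥MD1∥ _)

lemma2p5 : (n m : ℕ) → 1 ≤ n → n C 2 < 2 * m →
    (iso? : IsoDec n) → (P Q : List (Graph n)) →
    All (λ G → ∥ G ∥ ≡ m) P → All (λ G → ∥ G ∥ ≡ m) Q →
    ((∀ H → ∥ H ∥ ≡ m ∸ 1 → (d1 iso? ·X P) H ≡ (d1 iso? ·X Q) H)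
      ⊎ (∀ H → ∥ H ∥ ≡ m → (Δ1 iso? ·X P) H ≡ (Δ1 iso? ·X Q) H)) →
    ∀ H → ∥ H ∥ ≡ m → X iso? P H ≡ X iso? Q H
lemma2p5 n m _ N<2m iso? P Q rankP rankQ deck-agreement H _ = ℤ.+-injective (begin
    + X iso? P H
  ≡⟨ sym (∑-indicator H P) ⟩
    ∑ P (indicator H)
  ≡⟨ sums-agree N<m+m rankP rankQ (deck-agreement⇒DU-agreement iso? rankP rankQ deck-agreement)
                (indicator-invariant H) ⟩
    ∑ Q (indicator H)
  ≡⟨ ∑-indicator H Q ⟩
    + X iso? Q H
  ∎)
  where
  open ≡-Reasoning
  open Counting (≅-decSetoid iso?)
  N<m+m : n C 2 < m ℕ.+ m
  N<m+m = subst (n C 2 <_) (cong (m ℕ.+_) (ℕ.+-identityʳ m)) N<2m
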